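{- Let $\Delta$ be a finite simplicial complex that is a near-cone with apex vertex $a$. Then: (1) For every $r$, the quantity $f_r(\operatorname{link}_\Delta v)$, as $v$ ranges over the vertices of $\Delta$, is maximized at $v=a$. (2) If $\mathcal{A}$ is a family of $r$-element faces of $\Delta$, then after applying the operation $\operatorname{Shift}_{a\leftarrow w}$ to $\mathcal{A}$ for each vertex $w\neq a$ (successively), the resulting family $\mathcal{A}'$ is shifted with respect to $a$, i.e. whenever $A\in\mathcal{A}'$ with $w\in A$ and $a\notin A$, also $(A\setminus\{w\})\cup\{a\}\in\mathcal{A}'$.
   Context: A simplicial complex is a finite nonempty family of sets closed under taking subsets; $f_k(\Gamma)$ is the number of $k$-element faces of $\Gamma$; $\operatorname{link}_\Delta v=\{B\in\Delta: v\notin B,\ B\cup\{v\}\in\Delta\}$. $\Delta$ is a near-cone with apex vertex $a$ if whenever $B\in\Delta$ and $w\in B$, also $(B\setminus\{w\})\cup\{a\}\in\Delta$. For a set family $\mathcal{A}$ and elements $v,w$, the combinatorial shift is $\operatorname{Shift}_{v\leftarrow w}\mathcal{A}=\{A\in\mathcal{A}: w\notin A\text{ or }v\in A\text{ or }(A\setminus\{w\})\cup\{v\}\in\mathcal{A}\}\cup\{(A\setminus\{w\})\cup\{v\}: A\in\mathcal{A},\ w\in A,\ v\notin A\}$. -}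

module Defs where

open import Data.Nat using (ℕ; zero; suc; _≤_)
open import Data.Bool using (Bool; true; false; _∧_; _∨_; not; if_then_else_)
open import Data.Fin using (Fin)
open import Data.Fin.Subset using (Subset; _∈_; _∉_; _⊆_; ⁅_⁆; _∪_; _-_; ∣_∣; ⊥)
open import Data.List using (List; []; _∷_; map; _++_; filter; length; foldl; allFin)
open import Data.Bool.ListAction using (any)
open import Data.Vec using (Vec; []; _∷_; lookup)
open import Data.Vec.Properties using (≡-dec)
open import Data.Bool.Properties using () renaming (_≟_ to _≟ᵇ_)
open import Data.Nat.Properties using () renaming (_≟_ to _≟ℕ_)
open import Data.Fin.Properties using () renaming (_≟_ to _≟ᶠ_)
open import Relation.Nullary using (¬_)
open import Data.Product using (∃; _×_)
open import Relation.Nullary.Decidable using (⌊_⌋; ¬?)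
open import Relation.Binary.PropositionalEquality using (_≡_)
open import Data.List.Relation.Binary.Permutation.Propositional using (_↭_)

Family : ℕ → Set
Family n = Subset n → Bool

_∈ᵇ_ : ∀ {n} → Fin n → Subset n → Bool
v ∈ᵇ A = lookup A v

_==ˢ_ : ∀ {n} → Subset n → Subset n → Bool
A ==ˢ B = ⌊ ≡-dec _≟ᵇ_ A B ⌋

allSubsets : (n : ℕ) → List (Subset n)
allSubsets zero = [] ∷ []
allSubsets (suc n) = map (false ∷_) (allSubsets n) ++ map (true ∷_) (allSubsets n)

record IsSimplicialComplex {n : ℕ} (Δ : Family n) : Set where
  field
    nonempty   : ∃ λ (A : Subset n) → Δ A ≡ true
    downClosed : ∀ (A B : Subset n) → A ⊆ B → Δ B ≡ true → Δ A ≡ true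

IsVertex : ∀ {n} → Family n → Fin n → Set
IsVertex Δ v = Δ ⁅ v ⁆ ≡ true

count : ∀ {A : Set} → (A → Bool) → List A → ℕ
count p [] = zero
count p (x ∷ xs) = if p x then suc (count p xs) else count p xs

f : ∀ {n} → ℕ → Family n → ℕ
f {n} k Γ = count (λ B → ⌊ ∣ B ∣ ≟ℕ k ⌋ ∧ Γ B) (allSubsets n)

link : ∀ {n} → Family n → Fin n → Family n
link Δ v B = Δ B ∧ not (v ∈ᵇ B) ∧ Δ (B ∪ ⁅ v ⁆)

IsNearCone : ∀ {n} → Family n → Fin n → Set
IsNearCone {n} Δ a =
  ∀ (B : Subset n) (w : Fin n) → Δ B ≡ true → w ∈ B → Δ ((B - w) ∪ ⁅ a ⁆) ≡ true

Shift : ∀ {n} → Fin n → Fin n → Family n → Family n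
Shift {n} v w 𝒜 A =
  (𝒜 A ∧ (not (w ∈ᵇ A) ∨ (v ∈ᵇ A) ∨ 𝒜 ((A - w) ∪ ⁅ v ⁆)))
  ∨ any (λ A′ → 𝒜 A′ ∧ (w ∈ᵇ A′) ∧ not (v ∈ᵇ A′) ∧ (A ==ˢ ((A′ - w) ∪ ⁅ v ⁆)))
        (allSubsets n)

shiftAll : ∀ {n} → Fin n → List (Fin n) → Family n → Family n
shiftAll a ws 𝒜 = foldl (λ ℬ w → Shift a w ℬ) 𝒜 ws

othersThan : ∀ {n} → Fin n → List (Fin n)
othersThan {n} a = filter (λ w → ¬? (a ≟ᶠ w)) (allFin n)

ShiftedWrt : ∀ {n} → Family n → Fin n → Set
ShiftedWrt {n} 𝒜 a = ∀ (A : Subset n) (w : Fin n) →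
  𝒜 A ≡ true → w ∈ A → a ∉ A → 𝒜 ((A - w) ∪ ⁅ a ⁆) ≡ true

-- (1) Transposing the coordinates a and v maps the r-faces of link v injectively into those
-- of link a. If a ∉ B the transposition fixes B, and B ∪ {a} ∈ Δ because it lies below the
-- near-cone image ((B ∪ {v}) ∖ {v}) ∪ {a} of B ∪ {v}; if a ∈ B, the image and its union with a
-- both lie below B ∪ {v}. The transposition is an involution of the list of all subsets, so
-- counting over that list gives the inequality.
-- (2) Shift_{a←w} keeps every set containing a and creates no set avoiding a. Hence a set A ∌ a
-- of the final family was present at every stage; at the stage of a vertex w ∈ A it is moved to
-- (A ∖ {w}) ∪ {a}, which contains a and so survives all later shifts.
module Submission where

open import Defs
open import Data.Nat using (ℕ; zero; suc; _+_; _≤_; z≤n; s≤s)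
open import Data.Nat.Properties using (m≤n⇒m≤1+n; +-suc; +-cancelʳ-≡; module ≤-Reasoning)
  renaming (_≟_ to _≟ℕ_)
open import Data.Bool using (Bool; true; false; _∧_; _∨_; not; if_then_else_)
open import Data.Bool.Properties using (∨-zeroʳ; not-injective; T?; T-≡) renaming (_≟_ to _≟ᵇ_)
open import Data.Fin using (Fin; zero; suc)
open import Data.Fin.Properties using () renaming (_≟_ to _≟ᶠ_)
open import Data.Fin.Subset using (Subset; _∈_; _∉_; _⊆_; ⁅_⁆; _∪_; _-_; ∣_∣)
open import Data.Fin.Subset.Properties
  using (_∈?_; x∈⁅x⁆; x∈⁅y⁆⇒x≡y; p⊆p∪q; q⊆p∪q; x∈p∪q⁻; x∈p∧x≢y⇒x∈p-y; ⊆-trans)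
open import Data.List using (List; []; _∷_; map; filter; length)
open import Data.List.Membership.Propositional using (lose) renaming (_∈_ to _∈ˡ_)
open import Data.List.Membership.Propositional.Properties
  using (∈-map⁺; ∈-map⁻; ∈-++⁺ˡ; ∈-++⁺ʳ; ∈-filter⁺; ∈-allFin)
open import Data.List.Membership.Propositional.Properties.WithK using (unique∧set⇒bag)
open import Data.List.Relation.Binary.BagAndSetEquality using (∼bag⇒↭)
open import Data.List.Relation.Binary.Permutation.Propositional using (_↭_; ↭-sym)
open import Data.List.Relation.Binary.Permutation.Propositional.Properties
  using (∈-resp-↭; ↭-length; filter-↭)
open import Data.List.Relation.Unary.Any using (here; there; satisfied)
open import Data.List.Relation.Unary.Any.Properties using (any⁺; any⁻)
open import Data.List.Relation.Unary.All using ([])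
open import Data.List.Relation.Unary.AllPairs using ([]; _∷_)
open import Data.List.Relation.Unary.Unique.Propositional using (Unique)
import Data.List.Relation.Unary.Unique.Propositional.Properties as Unique
open import Data.Bool.ListAction using (any)
open import Data.Vec using ([]; _∷_; lookup; _[_]≔_)
open import Data.Vec.Properties
  using ( ≡-dec; []=⇒lookup; lookup⇒[]=; lookup∘update; lookup∘update′
        ; tabulate∘lookup; tabulate-cong; ∷-injectiveʳ)
open import Data.Product using (_×_; _,_; proj₁; proj₂; ∃)
open import Data.Sum using (_⊎_; inj₁; inj₂)
open import Function using (_∘_; mk⇔; Equivalence)
open import Relation.Nullary using (¬_; yes; no; contradiction)
open import Relation.Nullary.Decidable using (⌊_⌋; ¬?)
open import Relation.Binary.PropositionalEquality
  using (_≡_; _≢_; refl; sym; trans; cong; subst; ≢-sym; module ≡-Reasoning)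

∧-true⁻ : ∀ {x y} → x ∧ y ≡ true → x ≡ true × y ≡ true
∧-true⁻ {true} {true} _ = refl , refl

∧-true⁺ : ∀ {x y} → x ≡ true → y ≡ true → x ∧ y ≡ true
∧-true⁺ refl refl = refl

∨-true⁻ : ∀ {x y} → x ∨ y ≡ true → x ≡ true ⊎ y ≡ true
∨-true⁻ {true} _ = inj₁ refl
∨-true⁻ {false} y≡true = inj₂ y≡true

∨-true⁺ˡ : ∀ {x} y → x ≡ true → x ∨ y ≡ true
∨-true⁺ˡ _ refl = refl

∨-true⁺ʳ : ∀ x {y} → y ≡ true → x ∨ y ≡ true
∨-true⁺ʳ x refl = ∨-zeroʳ x

any-true⁻ : ∀ {A : Set} (p : A → Bool) xs → any p xs ≡ true → ∃ λ x → p x ≡ true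
any-true⁻ p xs h with satisfied (any⁻ p xs (Equivalence.from T-≡ h))
... | x , px = x , Equivalence.to T-≡ px

any-true⁺ : ∀ {A : Set} (p : A → Bool) {x xs} → x ∈ˡ xs → p x ≡ true → any p xs ≡ true
any-true⁺ p x∈xs px = Equivalence.to T-≡ (any⁺ p (lose x∈xs (Equivalence.from T-≡ px)))

==ˢ-true⁻ : ∀ {n} {A B : Subset n} → (A ==ˢ B) ≡ true → A ≡ B
==ˢ-true⁻ {A = A} {B} h with ≡-dec _≟ᵇ_ A B
... | yes A≡B = A≡B

==ˢ-refl : ∀ {n} (A : Subset n) → (A ==ˢ A) ≡ true
==ˢ-refl A with ≡-dec _≟ᵇ_ A A
... | yes _ = refl
... | no A≢A = contradiction refl A≢A

∈⇒∈ᵇ : ∀ {n} {x : Fin n} {p} → x ∈ p → x ∈ᵇ p ≡ true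
∈⇒∈ᵇ = []=⇒lookup

∈ᵇ⇒∈ : ∀ {n} {x : Fin n} {p} → x ∈ᵇ p ≡ true → x ∈ p
∈ᵇ⇒∈ {x = x} {p} = lookup⇒[]= x p

∉⇒∈ᵇ≡false : ∀ {n} {x : Fin n} {p} → x ∉ p → x ∈ᵇ p ≡ false
∉⇒∈ᵇ≡false {x = x} {p} x∉p with x ∈ᵇ p in eq
... | true = contradiction (∈ᵇ⇒∈ eq) x∉p
... | false = refl

∈ᵇ≡false⇒∉ : ∀ {n} {x : Fin n} {p} → x ∈ᵇ p ≡ false → x ∉ p
∈ᵇ≡false⇒∉ x∉p x∈p with () ← trans (sym (∈⇒∈ᵇ x∈p)) x∉p

≡-by-lookup : ∀ {n} {p q : Subset n} → (∀ i → lookup p i ≡ lookup q i) → p ≡ q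
≡-by-lookup {p = p} {q} h = trans (sym (tabulate∘lookup p)) (trans (tabulate-cong h) (tabulate∘lookup q))

module _ {A : Set} where

  count≡length∘filter : ∀ (p : A → Bool) xs → count p xs ≡ length (filter (T? ∘ p) xs)
  count≡length∘filter p [] = refl
  count≡length∘filter p (x ∷ xs) with p x
  ... | true = cong suc (count≡length∘filter p xs)
  ... | false = count≡length∘filter p xs

  count-↭ : ∀ (p : A → Bool) {xs ys} → xs ↭ ys → count p xs ≡ count p ys
  count-↭ p {xs} {ys} xs↭ys = begin
    count p xs                         ≡⟨ count≡length∘filter p xs ⟩
    length (filter (T? ∘ p) xs)        ≡⟨ ↭-length (filter-↭ (T? ∘ p) xs↭ys) ⟩
    length (filter (T? ∘ p) ys)        ≡⟨ sym (count≡length∘filter p ys) ⟩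
    count p ys                         ∎
    where open ≡-Reasoning

  count-map : ∀ {B : Set} (p : B → Bool) (g : A → B) xs → count p (map g xs) ≡ count (p ∘ g) xs
  count-map p g [] = refl
  count-map p g (x ∷ xs) = cong (λ k → if p (g x) then suc k else k) (count-map p g xs)

  count-mono : ∀ {p q : A → Bool} → (∀ x → p x ≡ true → q x ≡ true) → ∀ xs → count p xs ≤ count q xs
  count-mono p⇒q [] = z≤n
  count-mono {p} {q} p⇒q (x ∷ xs) with p x in px | q x in qx
  ... | true | true = s≤s (count-mono p⇒q xs)
  ... | true | false with () ← trans (sym (p⇒q x px)) qx
  ... | false | true = m≤n⇒m≤1+n (count-mono p⇒q xs)
  ... | false | false = count-mono p⇒q xs

  map-involution-↭ : ∀ {σ : A → A} {xs} → (∀ x → σ (σ x) ≡ x) → Unique xs → (∀ x → x ∈ˡ xs) →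
                     map σ xs ↭ xs
  map-involution-↭ {σ} {xs} σσ≗id unique complete =
    ∼bag⇒↭ (unique∧set⇒bag (Unique.map⁺ σ-injective unique) unique
              (λ {x} → mk⇔ (λ _ → complete x)
                            (λ _ → subst (_∈ˡ map σ xs) (σσ≗id x) (∈-map⁺ σ (complete (σ x))))))
    where
    σ-injective : ∀ {x y} → σ x ≡ σ y → x ≡ y
    σ-injective {x} {y} σx≡σy = trans (sym (σσ≗id x)) (trans (cong σ σx≡σy) (σσ≗id y))

  count-≤-by-involution : ∀ {p q : A → Bool} (σ : A → A) → (∀ x → σ (σ x) ≡ x) →
                          (∀ x → p x ≡ true → q (σ x) ≡ true) →
                          ∀ {xs} → Unique xs → (∀ x → x ∈ˡ xs) → count p xs ≤ count q xs
  count-≤-by-involution {p} {q} σ σσ≗id p⇒qσ {xs} unique complete = begin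
    count p xs          ≤⟨ count-mono p⇒qσ xs ⟩
    count (q ∘ σ) xs    ≡⟨ sym (count-map q σ xs) ⟩
    count q (map σ xs)  ≡⟨ count-↭ q (map-involution-↭ σσ≗id unique complete) ⟩
    count q xs          ∎
    where open ≤-Reasoning

∈-allSubsets : ∀ {n} (p : Subset n) → p ∈ˡ allSubsets n
∈-allSubsets [] = here refl
∈-allSubsets {suc n} (false ∷ p) = ∈-++⁺ˡ (∈-map⁺ (false ∷_) (∈-allSubsets p))
∈-allSubsets {suc n} (true ∷ p) =
  ∈-++⁺ʳ (map (false ∷_) (allSubsets n)) (∈-map⁺ (true ∷_) (∈-allSubsets p))

allSubsets-unique : ∀ n → Unique (allSubsets n)
allSubsets-unique zero = [] ∷ []
allSubsets-unique (suc n) =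
  Unique.++⁺ (Unique.map⁺ ∷-injectiveʳ (allSubsets-unique n))
             (Unique.map⁺ ∷-injectiveʳ (allSubsets-unique n))
             disjoint
  where
  disjoint : ∀ {p} → ¬ (p ∈ˡ map (false ∷_) (allSubsets n) × p ∈ˡ map (true ∷_) (allSubsets n))
  disjoint (p∈ˡfalse∷ , p∈ˡtrue∷) with ∈-map⁻ (false ∷_) p∈ˡfalse∷ | ∈-map⁻ (true ∷_) p∈ˡtrue∷
  ... | _ , _ , refl | _ , _ , ()

bit : Bool → ℕ
bit true = 1
bit false = 0

∣p[i]≔x∣ : ∀ {n} (p : Subset n) i x → ∣ p [ i ]≔ x ∣ + bit (lookup p i) ≡ ∣ p ∣ + bit x
∣p[i]≔x∣ (true ∷ p) zero true = refl
∣p[i]≔x∣ (true ∷ p) zero false = +-suc ∣ p ∣ 0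
∣p[i]≔x∣ (false ∷ p) zero true = sym (+-suc ∣ p ∣ 0)
∣p[i]≔x∣ (false ∷ p) zero false = refl
∣p[i]≔x∣ (true ∷ p) (suc i) x = cong suc (∣p[i]≔x∣ p i x)
∣p[i]≔x∣ (false ∷ p) (suc i) x = ∣p[i]≔x∣ p i x

module _ {n} (a v : Fin n) where

  swap : Subset n → Subset n
  swap p = p [ a ]≔ lookup p v [ v ]≔ lookup p a

  lookup-[a]≔-v : ∀ (p : Subset n) → lookup (p [ a ]≔ lookup p v) v ≡ lookup p v
  lookup-[a]≔-v p with a ≟ᶠ v
  ... | yes refl = lookup∘update a p (lookup p a)
  ... | no a≢v = lookup∘update′ (≢-sym a≢v) p (lookup p v)

  lookup-swap-a : ∀ (p : Subset n) → lookup (swap p) a ≡ lookup p v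
  lookup-swap-a p with a ≟ᶠ v
  ... | yes refl = lookup∘update a (p [ a ]≔ lookup p a) (lookup p a)
  ... | no a≢v = trans (lookup∘update′ a≢v (p [ a ]≔ lookup p v) (lookup p a))
                       (lookup∘update a p (lookup p v))

  lookup-swap-v : ∀ (p : Subset n) → lookup (swap p) v ≡ lookup p a
  lookup-swap-v p = lookup∘update v (p [ a ]≔ lookup p v) (lookup p a)

  lookup-swap-other : ∀ (p : Subset n) {u} → u ≢ a → u ≢ v → lookup (swap p) u ≡ lookup p u
  lookup-swap-other p u≢a u≢v = trans (lookup∘update′ u≢v (p [ a ]≔ lookup p v) (lookup p a))
                                      (lookup∘update′ u≢a p (lookup p v))

  ≡-by-lookup-at-a-v : ∀ {p q : Subset n} → lookup p a ≡ lookup q a → lookup p v ≡ lookup q v →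
                       (∀ {u} → u ≢ a → u ≢ v → lookup p u ≡ lookup q u) → p ≡ q
  ≡-by-lookup-at-a-v {p} {q} pa≡qa pv≡qv others = ≡-by-lookup at
    where
    at : ∀ u → lookup p u ≡ lookup q u
    at u with u ≟ᶠ a | u ≟ᶠ v
    ... | yes refl | _ = pa≡qa
    ... | no _ | yes refl = pv≡qv
    ... | no u≢a | no u≢v = others u≢a u≢v

  swap-involutive : ∀ (p : Subset n) → swap (swap p) ≡ p
  swap-involutive p = ≡-by-lookup-at-a-v
    (trans (lookup-swap-a (swap p)) (lookup-swap-v p))
    (trans (lookup-swap-v (swap p)) (lookup-swap-a p))
    (λ u≢a u≢v → trans (lookup-swap-other (swap p) u≢a u≢v) (lookup-swap-other p u≢a u≢v))

  swap-fixes : ∀ (p : Subset n) → lookup p a ≡ lookup p v → swap p ≡ p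
  swap-fixes p pa≡pv = ≡-by-lookup-at-a-v
    (trans (lookup-swap-a p) (sym pa≡pv))
    (trans (lookup-swap-v p) pa≡pv)
    (lookup-swap-other p)

  ∣swap∣ : ∀ (p : Subset n) → ∣ swap p ∣ ≡ ∣ p ∣
  ∣swap∣ p = +-cancelʳ-≡ (bit (lookup p v)) ∣ swap p ∣ ∣ p ∣ (begin
    ∣ swap p ∣ + bit (lookup p v)           ≡⟨ cong (λ b → ∣ swap p ∣ + bit b) (sym (lookup-[a]≔-v p)) ⟩
    ∣ swap p ∣ + bit (lookup p′ v)          ≡⟨ ∣p[i]≔x∣ p′ v (lookup p a) ⟩
    ∣ p′ ∣ + bit (lookup p a)               ≡⟨ ∣p[i]≔x∣ p a (lookup p v) ⟩
    ∣ p ∣ + bit (lookup p v)                ∎)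
    where
    open ≡-Reasoning
    p′ : Subset n
    p′ = p [ a ]≔ lookup p v

x∉p⇒p∪⁅y⁆⊆p∪⁅x⁆-x∪⁅y⁆ : ∀ {n} {p : Subset n} {x} y → x ∉ p → p ∪ ⁅ y ⁆ ⊆ ((p ∪ ⁅ x ⁆) - x) ∪ ⁅ y ⁆
x∉p⇒p∪⁅y⁆⊆p∪⁅x⁆-x∪⁅y⁆ {p = p} {x} y x∉p {u} u∈p∪y with x∈p∪q⁻ p ⁅ y ⁆ u∈p∪y
... | inj₁ u∈p = p⊆p∪q ⁅ y ⁆ (x∈p∧x≢y⇒x∈p-y (p⊆p∪q ⁅ x ⁆ u∈p) (λ { refl → x∉p u∈p }))
... | inj₂ u∈⁅y⁆ = q⊆p∪q _ ⁅ y ⁆ u∈⁅y⁆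

swap∪⁅a⁆⊆p∪⁅v⁆ : ∀ {n} {a v : Fin n} {p} → a ∈ p → swap a v p ∪ ⁅ a ⁆ ⊆ p ∪ ⁅ v ⁆
swap∪⁅a⁆⊆p∪⁅v⁆ {a = a} {v} {p} a∈p {u} u∈ with u ≟ᶠ v | u ≟ᶠ a
... | yes refl | _ = q⊆p∪q p ⁅ u ⁆ (x∈⁅x⁆ u)
... | no _ | yes refl = p⊆p∪q ⁅ v ⁆ a∈p
... | no u≢v | no u≢a with x∈p∪q⁻ (swap a v p) ⁅ a ⁆ u∈
...   | inj₁ u∈swap = p⊆p∪q ⁅ v ⁆ (∈ᵇ⇒∈ (trans (sym (lookup-swap-other a v p u≢a u≢v)) (∈⇒∈ᵇ u∈swap)))
...   | inj₂ u∈⁅a⁆ = contradiction (x∈⁅y⁆⇒x≡y a u∈⁅a⁆) u≢a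

a∉swap : ∀ {n} {a v : Fin n} {p} → v ∉ p → a ∉ swap a v p
a∉swap {a = a} {v} {p} v∉p = ∈ᵇ≡false⇒∉ (trans (lookup-swap-a a v p) (∉⇒∈ᵇ≡false v∉p))

link-true⁻ : ∀ {n} {Δ : Family n} {v B} → link Δ v B ≡ true → Δ B ≡ true × v ∉ B × Δ (B ∪ ⁅ v ⁆) ≡ true
link-true⁻ {Δ = Δ} {v} {B} h with ∧-true⁻ {Δ B} h
... | ΔB , rest with ∧-true⁻ {not (v ∈ᵇ B)} rest
... | v∉B , ΔB∪v = ΔB , ∈ᵇ≡false⇒∉ (not-injective v∉B) , ΔB∪v

link-true⁺ : ∀ {n} {Δ : Family n} {v B} → Δ B ≡ true → v ∉ B → Δ (B ∪ ⁅ v ⁆) ≡ true → link Δ v B ≡ true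
link-true⁺ ΔB v∉B ΔB∪v = ∧-true⁺ ΔB (∧-true⁺ (cong not (∉⇒∈ᵇ≡false v∉B)) ΔB∪v)

module _ {n} {Δ : Family n} (sc : IsSimplicialComplex Δ) {a : Fin n} (nc : IsNearCone Δ a) where
  open IsSimplicialComplex sc using (downClosed)

  swap-link : ∀ {v B} → link Δ v B ≡ true → link Δ a (swap a v B) ≡ true
  swap-link {v} {B} h with link-true⁻ {Δ = Δ} h | a ∈? B
  ... | ΔB , v∉B , ΔB∪v | no a∉B =
    subst (λ C → link Δ a C ≡ true) (sym B-fixed) (link-true⁺ {Δ = Δ} ΔB a∉B ΔB∪a)
    where
    B-fixed : swap a v B ≡ B
    B-fixed = swap-fixes a v B (trans (∉⇒∈ᵇ≡false a∉B) (sym (∉⇒∈ᵇ≡false v∉B)))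
    ΔB∪a : Δ (B ∪ ⁅ a ⁆) ≡ true
    ΔB∪a = downClosed _ _ (x∉p⇒p∪⁅y⁆⊆p∪⁅x⁆-x∪⁅y⁆ a v∉B)
                          (nc (B ∪ ⁅ v ⁆) v ΔB∪v (q⊆p∪q B ⁅ v ⁆ (x∈⁅x⁆ v)))
  ... | ΔB , v∉B , ΔB∪v | yes a∈B =
    link-true⁺ {Δ = Δ} (downClosed _ _ (⊆-trans (p⊆p∪q ⁅ a ⁆) below) ΔB∪v) (a∉swap v∉B) (downClosed _ _ below ΔB∪v)
    where
    below : swap a v B ∪ ⁅ a ⁆ ⊆ B ∪ ⁅ v ⁆
    below = swap∪⁅a⁆⊆p∪⁅v⁆ a∈B

  f-link≤f-link-apex : ∀ r v → f r (link Δ v) ≤ f r (link Δ a)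
  f-link≤f-link-apex r v =
    count-≤-by-involution (swap a v) (swap-involutive a v) preserved (allSubsets-unique n) ∈-allSubsets
    where
    preserved : ∀ B → (⌊ ∣ B ∣ ≟ℕ r ⌋ ∧ link Δ v B) ≡ true →
                (⌊ ∣ swap a v B ∣ ≟ℕ r ⌋ ∧ link Δ a (swap a v B)) ≡ true
    preserved B h with ∧-true⁻ {⌊ ∣ B ∣ ≟ℕ r ⌋} h
    ... | ∣B∣≡r , B∈link =
      ∧-true⁺ (trans (cong (λ k → ⌊ k ≟ℕ r ⌋) (∣swap∣ a v B)) ∣B∣≡r) (swap-link B∈link)

module _ {n} (a : Fin n) where

  -- Shift a w 𝒜 A unfolds to stays 𝒜 w A ∨ any (movedOnto 𝒜 w A) (allSubsets n).
  stays : Family n → Fin n → Subset n → Bool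
  stays 𝒜 w A = 𝒜 A ∧ (not (w ∈ᵇ A) ∨ (a ∈ᵇ A) ∨ 𝒜 ((A - w) ∪ ⁅ a ⁆))

  movedOnto : Family n → Fin n → Subset n → Subset n → Bool
  movedOnto 𝒜 w A A′ = 𝒜 A′ ∧ (w ∈ᵇ A′) ∧ not (a ∈ᵇ A′) ∧ (A ==ˢ ((A′ - w) ∪ ⁅ a ⁆))

  movedOnto-true⁻ : ∀ 𝒜 w {A A′} → movedOnto 𝒜 w A A′ ≡ true → A ≡ (A′ - w) ∪ ⁅ a ⁆
  movedOnto-true⁻ 𝒜 w {A′ = A′} h with ∧-true⁻ {𝒜 A′} h
  ... | _ , h′ with ∧-true⁻ {w ∈ᵇ A′} h′
  ... | _ , h″ = ==ˢ-true⁻ (proj₂ (∧-true⁻ {not (a ∈ᵇ A′)} h″))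

  movedOnto-true⁺ : ∀ 𝒜 w {A} → 𝒜 A ≡ true → w ∈ A → a ∉ A → movedOnto 𝒜 w ((A - w) ∪ ⁅ a ⁆) A ≡ true
  movedOnto-true⁺ 𝒜 w {A} 𝒜A w∈A a∉A =
    ∧-true⁺ 𝒜A (∧-true⁺ (∈⇒∈ᵇ w∈A) (∧-true⁺ (cong not (∉⇒∈ᵇ≡false a∉A)) (==ˢ-refl ((A - w) ∪ ⁅ a ⁆))))

  Shift-reflects-∌ : ∀ w 𝒜 {A} → Shift a w 𝒜 A ≡ true → a ∉ A → 𝒜 A ≡ true
  Shift-reflects-∌ w 𝒜 {A} h a∉A with ∨-true⁻ {stays 𝒜 w A} h
  ... | inj₁ A-stays = proj₁ (∧-true⁻ {𝒜 A} A-stays)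
  ... | inj₂ A-new with any-true⁻ (movedOnto 𝒜 w A) (allSubsets n) A-new
  ...   | A′ , A′-moved =
    contradiction (subst (a ∈_) (sym (movedOnto-true⁻ 𝒜 w A′-moved)) (q⊆p∪q (A′ - w) ⁅ a ⁆ (x∈⁅x⁆ a))) a∉A

  Shift-preserves-∋ : ∀ w 𝒜 {A} → 𝒜 A ≡ true → a ∈ A → Shift a w 𝒜 A ≡ true
  Shift-preserves-∋ w 𝒜 {A} 𝒜A a∈A =
    ∨-true⁺ˡ _ (∧-true⁺ 𝒜A (∨-true⁺ʳ (not (w ∈ᵇ A)) (∨-true⁺ˡ _ (∈⇒∈ᵇ a∈A))))

  Shift-moves : ∀ w 𝒜 {A} → Shift a w 𝒜 A ≡ true → w ∈ A → a ∉ A → Shift a w 𝒜 ((A - w) ∪ ⁅ a ⁆) ≡ true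
  Shift-moves w 𝒜 {A} h w∈A a∉A =
    ∨-true⁺ʳ (stays 𝒜 w ((A - w) ∪ ⁅ a ⁆))
      (any-true⁺ (movedOnto 𝒜 w ((A - w) ∪ ⁅ a ⁆)) (∈-allSubsets A)
                 (movedOnto-true⁺ 𝒜 w (Shift-reflects-∌ w 𝒜 h a∉A) w∈A a∉A))

  shiftAll-reflects-∌ : ∀ ws 𝒜 {A} → shiftAll a ws 𝒜 A ≡ true → a ∉ A → 𝒜 A ≡ true
  shiftAll-reflects-∌ [] 𝒜 h a∉A = h
  shiftAll-reflects-∌ (w ∷ ws) 𝒜 h a∉A =
    Shift-reflects-∌ w 𝒜 (shiftAll-reflects-∌ ws (Shift a w 𝒜) h a∉A) a∉A

  shiftAll-preserves-∋ : ∀ ws 𝒜 {A} → 𝒜 A ≡ true → a ∈ A → shiftAll a ws 𝒜 A ≡ true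
  shiftAll-preserves-∋ [] 𝒜 𝒜A a∈A = 𝒜A
  shiftAll-preserves-∋ (w ∷ ws) 𝒜 𝒜A a∈A =
    shiftAll-preserves-∋ ws (Shift a w 𝒜) (Shift-preserves-∋ w 𝒜 𝒜A a∈A) a∈A

  shiftAll-moves : ∀ ws 𝒜 {w A} → w ∈ˡ ws → shiftAll a ws 𝒜 A ≡ true → w ∈ A → a ∉ A →
                   shiftAll a ws 𝒜 ((A - w) ∪ ⁅ a ⁆) ≡ true
  shiftAll-moves (w ∷ ws) 𝒜 (here refl) h w∈A a∉A =
    shiftAll-preserves-∋ ws (Shift a w 𝒜)
      (Shift-moves w 𝒜 (shiftAll-reflects-∌ ws (Shift a w 𝒜) h a∉A) w∈A a∉A)
      (q⊆p∪q _ ⁅ a ⁆ (x∈⁅x⁆ a))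
  shiftAll-moves (w′ ∷ ws) 𝒜 (there w∈ws) h w∈A a∉A = shiftAll-moves ws (Shift a w′ 𝒜) w∈ws h w∈A a∉A

  shiftAll-shifted : ∀ ws 𝒜 → (∀ {w} → a ≢ w → w ∈ˡ ws) → ShiftedWrt (shiftAll a ws 𝒜) a
  shiftAll-shifted ws 𝒜 covers A w h w∈A a∉A =
    shiftAll-moves ws 𝒜 (covers λ { refl → a∉A w∈A }) h w∈A a∉A

∈-othersThan : ∀ {n} {a w : Fin n} → a ≢ w → w ∈ˡ othersThan a
∈-othersThan {a = a} {w} a≢w = ∈-filter⁺ (λ w → ¬? (a ≟ᶠ w)) (∈-allFin w) a≢w

lemma2p14 : ∀ {n : ℕ} (Δ : Family n) (a : Fin n) →
    IsSimplicialComplex Δ → IsVertex Δ a → IsNearCone Δ a →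
    (∀ (r : ℕ) (v : Fin n) → IsVertex Δ v → f r (link Δ v) ≤ f r (link Δ a))
    × (∀ (r : ℕ) (𝒜 : Family n) →
         (∀ (A : Subset n) → 𝒜 A ≡ true → (Δ A ≡ true × ∣ A ∣ ≡ r)) →
         ∀ (ws : List (Fin n)) → ws ↭ othersThan a →
         ShiftedWrt (shiftAll a ws 𝒜) a)
lemma2p14 Δ a sc _ nc =
  (λ r v _ → f-link≤f-link-apex sc nc r v) ,
  (λ r 𝒜 _ ws ws↭others →
     shiftAll-shifted a ws 𝒜 (λ a≢w → ∈-resp-↭ (↭-sym ws↭others) (∈-othersThan a≢w)))
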